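{- Let $X$ be a regular multigraph (multiple edges allowed) of odd valency. Then $X$ is class I if and only if its complete truncation is class I.
   Context: Complete truncation of $X$: for each edge $e=[u,v]$ of $X$ take a new edge (these form a matching) whose two ends are labelled $u$ and $v$; for each vertex $v$ of $X$ let $\mathrm{cl}(v)$ be the set of ends labelled $v$ and insert the complete graph on $\mathrm{cl}(v)$. The resulting graph is the complete truncation. A multigraph is class I if its chromatic index (minimum number of colors in a proper edge coloring) equals its maximum valency. -}

module Defs where

import Data.Nat
open import Data.Nat using (ℕ; zero; suc; _⊔_; _≤_; _<_; _+_; _*_)
open import Data.Product using (∃)
open import Data.Nat.Properties using (_<?_)
open import Data.Fin using (Fin; zero; suc; toℕ; combine; remQuot; _≟_)
open import Data.List using (List; []; _∷_; length; lookup; map; filter; concatMap; foldr; allFin; _++_)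
open import Data.List.Relation.Unary.All using (All)
open import Data.Product using (_×_; _,_; proj₁; proj₂)
open import Data.Sum using (_⊎_)
open import Relation.Nullary using (¬_)
open import Relation.Nullary.Decidable using (_⊎-dec_; _×-dec_)
open import Relation.Binary.PropositionalEquality using (_≡_; _≢_)

-- A finite multigraph on vertex set Fin n, given by its list of edges
-- (each edge = pair of end-vertices; parallel edges = repeated entries).
record Multigraph : Set where
  constructor mkGraph
  field
    n     : ℕ
    edges : List (Fin n × Fin n)
open Multigraph public

Edge : Multigraph → Set
Edge G = Fin (length (edges G))

ends : (G : Multigraph) → Edge G → Fin (n G) × Fin (n G)
ends G e = lookup (edges G) e

Loopless : Multigraph → Set
Loopless G = All (λ uv → proj₁ uv ≢ proj₂ uv) (edges G)

valency : (G : Multigraph) → Fin (n G) → ℕ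
valency G v = length (filter (λ uv → (proj₁ uv ≟ v) ⊎-dec (proj₂ uv ≟ v)) (edges G))

Regular : Multigraph → ℕ → Set
Regular G k = ∀ v → valency G v ≡ k

Odd : ℕ → Set
Odd k = ∃ λ j → k ≡ suc (j + j)

-- maximum valency (0 for the graph with no vertices)
maxValency : Multigraph → ℕ
maxValency G = foldr _⊔_ 0 (map (valency G) (allFin (n G)))

ShareEnd : {N : ℕ} → Fin N × Fin N → Fin N × Fin N → Set
ShareEnd (a , b) (c , d) = (a ≡ c ⊎ a ≡ d) ⊎ (b ≡ c ⊎ b ≡ d)

ProperEdgeColouring : (G : Multigraph) (k : ℕ) → (Edge G → Fin k) → Set
ProperEdgeColouring G k c =
  ∀ e f → e ≢ f → ShareEnd (ends G e) (ends G f) → c e ≢ c f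

EdgeColourable : Multigraph → ℕ → Set
EdgeColourable G k = ∃ λ (c : Edge G → Fin k) → ProperEdgeColouring G k c

IsChromaticIndex : Multigraph → ℕ → Set
IsChromaticIndex G k = EdgeColourable G k × (∀ j → EdgeColourable G j → k ≤ j)

ClassI : Multigraph → Set
ClassI G = IsChromaticIndex G (maxValency G)

-- Complete truncation.  The end (e , b) of the new edge for edge e
-- (b = 0 for the first end-vertex, b = 1 for the second) is the vertex
-- combine e b of Fin (m * 2).
module _ (G : Multigraph) where
  private
    m = length (edges G)

  endLabel : Fin (m * 2) → Fin (n G)
  endLabel x with remQuot 2 x
  ... | e , zero  = proj₁ (ends G e)
  ... | e , suc _ = proj₂ (ends G e)

  allEnds : List (Fin (m * 2))
  allEnds = allFin (m * 2)

  matchingEdges : List (Fin (m * 2) × Fin (m * 2))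
  matchingEdges = map (λ e → combine e zero , combine e (suc zero)) (allFin m)

  -- for each vertex v, complete graph on cl(v): every unordered pair of
  -- distinct ends with the same label, listed once (a < b)
  cliqueEdges : List (Fin (m * 2) × Fin (m * 2))
  cliqueEdges =
    filter (λ ab → (toℕ (proj₁ ab) <? toℕ (proj₂ ab)) ×-dec (endLabel (proj₁ ab) ≟ endLabel (proj₂ ab)))
      (concatMap (λ a → map (λ b → a , b) allEnds) allEnds)

  completeTruncation : Multigraph
  completeTruncation = mkGraph (m * 2) (matchingEdges ++ cliqueEdges)

-- Write k = 2j + 1. Given a proper k-colouring c of X, give the matching edge of e the colour c e
-- and the clique edge joining the ends y, z of cl(v) the colour (c y + c z)/2 mod k, where c y is
-- the colour of the edge of X through y: the ends in cl(v) carry distinct colours, and the midpoint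
-- of two distinct colours differs from both and determines each of them from the other.
-- Conversely, in a proper k-colouring of the truncation every cl(v) spans K_k with a pendant
-- (matching) edge at each vertex, so each vertex sees all k colours. For a colour δ the δ-coloured
-- clique edges pair up the vertices whose pendant edge is not coloured δ; these are evenly many, so
-- as k is odd some pendant edge at cl(v) has colour δ. Hence the k pendant colours at cl(v) are
-- distinct, and colouring each edge of X like its matching edge is proper. Both graphs are
-- k-regular, so being class I means being k-edge-colourable.
module Submission where

open import Defs
open import Data.Nat using (ℕ; zero; suc; _+_; _*_; _∸_; _≤_; _<_; _⊔_; z≤n; s≤s; NonZero)
import Data.Nat.Properties as ℕ
open import Data.Nat.DivMod using (_%_; _/_; _mod_; m%n<n; m≡m%n+[m/n]*n; %-distribˡ-+; [m+n]%n≡m%n; [m+kn]%n≡m%n; m<n⇒m%n≡m)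
open import Data.Nat.Solver using (module +-*-Solver)
open +-*-Solver using (solve; _:+_; _:*_; _:=_; con)
open import Algebra.Properties.Semiring.Sum ℕ.+-*-semiring
  using (sum; sum-syntax; sum-cong-≗; ∑-distrib-+; ∑-comm; sum-replicate-zero; *-distribˡ-sum; *-distribʳ-sum)
open import Data.Fin using (Fin; zero; suc; toℕ; combine; remQuot; _≟_; _↑ˡ_; _↑ʳ_)
import Data.Fin as Fin
open import Data.Fin.Properties
  using (suc-injective; <-cmp; <-asym; any?; toℕ-fromℕ<; toℕ<n; toℕ-injective; remQuot-combine; combine-remQuot; combine-injectiveˡ)
  renaming (_<?_ to _<ᶠ?_)
open import Data.List using (List; []; _∷_; length; lookup; map; filter; concatMap; concat; tabulate; allFin; _++_; cartesianProduct; foldr)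
open import Data.List.Properties using (foldr-preservesᵇ)
import Data.List.Relation.Unary.All as All
import Data.List.Relation.Unary.All.Properties as All
open import Data.List.Relation.Unary.Any using (index; here; there)
open import Data.List.Relation.Unary.Any.Properties using (lookup-index)
open import Data.List.Membership.Propositional using (_∈_)
open import Data.List.Membership.Propositional.Properties
  using (∈-allFin; ∈-lookup; ∈-++⁺ˡ; ∈-++⁺ʳ; ∈-++⁻; ∈-map⁺; ∈-map⁻; ∈-filter⁺; ∈-filter⁻; ∈-cartesianProduct⁺)
open import Data.List.Relation.Unary.Unique.Propositional using (Unique)
import Data.List.Relation.Unary.Unique.Propositional.Properties as Unique
open import Data.List.Relation.Unary.AllPairs using (_∷_)
open import Data.Product using (∃; _×_; _,_; proj₁; proj₂)
open import Data.Sum using (_⊎_; inj₁; inj₂; [_,_]′)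
open import Data.Empty using (⊥-elim)
open import Function.Bundles using (_⇔_; mk⇔; Equivalence)
open import Function.Properties.Equivalence using (⇔-setoid)
open import Level using (0ℓ)
open import Relation.Nullary using (Dec; yes; no; ¬_)
open import Relation.Nullary.Decidable using (_×-dec_; _⊎-dec_; ¬?)
open import Relation.Unary using (Pred; Decidable)
open import Relation.Binary using (Rel; Symmetric; tri<; tri≈; tri>)
  renaming (Decidable to Decidable₂)
open import Relation.Binary.PropositionalEquality

𝟙 : ∀ {p} {P : Set p} → Dec P → ℕ
𝟙 (yes _) = 1
𝟙 (no _)  = 0

𝟙-yes : ∀ {p} {P : Set p} → P → (P? : Dec P) → 𝟙 P? ≡ 1
𝟙-yes _ (yes _) = refl
𝟙-yes p (no ¬p) = ⊥-elim (¬p p)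

𝟙-no : ∀ {p} {P : Set p} → ¬ P → (P? : Dec P) → 𝟙 P? ≡ 0
𝟙-no ¬p (yes p) = ⊥-elim (¬p p)
𝟙-no ¬p (no _)  = refl

𝟙-cong : ∀ {p q} {P : Set p} {Q : Set q} → (P → Q) → (Q → P) →
         (P? : Dec P) (Q? : Dec Q) → 𝟙 P? ≡ 𝟙 Q?
𝟙-cong f g (yes p) Q? = sym (𝟙-yes (f p) Q?)
𝟙-cong f g (no ¬p) Q? = sym (𝟙-no (λ q → ¬p (g q)) Q?)

𝟙-⊎ : ∀ {p q r} {P : Set p} {Q : Set q} {R : Set r} (P? : Dec P) (Q? : Dec Q) (R? : Dec R) →
      (P → Q ⊎ R) → (Q → P) → (R → P) → (Q → ¬ R) → 𝟙 P? ≡ 𝟙 Q? + 𝟙 R?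
𝟙-⊎ (yes p) (yes q) (yes r) _   _   _   q∧r = ⊥-elim (q∧r q r)
𝟙-⊎ (yes p) (yes q) (no _)  _   _   _   _   = refl
𝟙-⊎ (yes p) (no _)  (yes r) _   _   _   _   = refl
𝟙-⊎ (yes p) (no ¬q) (no ¬r) q∨r _   _   _   = ⊥-elim ([ ¬q , ¬r ]′ (q∨r p))
𝟙-⊎ (no ¬p) (yes q) _       _   q⇒p _   _   = ⊥-elim (¬p (q⇒p q))
𝟙-⊎ (no ¬p) (no _)  (yes r) _   _   r⇒p _   = ⊥-elim (¬p (r⇒p r))
𝟙-⊎ (no ¬p) (no _)  (no _)  _   _   _   _   = refl

count : ∀ {n p} {P : Pred (Fin n) p} → Decidable P → ℕ
count {n} P? = ∑[ i < n ] 𝟙 (P? i)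

∑-one : ∀ n → ∑[ i < n ] 1 ≡ n
∑-one zero    = refl
∑-one (suc n) = cong suc (∑-one n)

∑-mono-≤ : ∀ {n} {f g : Fin n → ℕ} → (∀ i → f i ≤ g i) → sum f ≤ sum g
∑-mono-≤ {zero}  f≤g = z≤n
∑-mono-≤ {suc n} f≤g = ℕ.+-mono-≤ (f≤g zero) (∑-mono-≤ (λ i → f≤g (suc i)))

count-none : ∀ {n p} {P : Pred (Fin n) p} (P? : Decidable P) → (∀ i → ¬ P i) → count P? ≡ 0
count-none {n} P? ¬P = trans (sum-cong-≗ (λ i → 𝟙-no (¬P i) (P? i))) (sum-replicate-zero n)

count-≤1 : ∀ {n p} {P : Pred (Fin n) p} (P? : Decidable P) → (∀ i j → P i → P j → i ≡ j) → count P? ≤ 1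
count-≤1 {zero}  P? uniq = z≤n
count-≤1 {suc n} P? uniq with P? zero
... | yes p₀ = ℕ.≤-reflexive (cong suc (count-none (λ i → P? (suc i)) (λ i pᵢ → zero≢suc (uniq zero (suc i) p₀ pᵢ))))
  where zero≢suc : ∀ {i : Fin n} → zero ≢ suc i
        zero≢suc ()
... | no _   = count-≤1 (λ i → P? (suc i)) (λ i j pᵢ pⱼ → suc-injective (uniq (suc i) (suc j) pᵢ pⱼ))

count-singleton : ∀ {n} (a : Fin n) → count (_≟ a) ≡ 1
count-singleton {suc n} zero    = cong suc (count-none {n} (λ i → suc i ≟ zero) (λ i ()))
count-singleton {suc n} (suc a) = trans (sum-cong-≗ (λ i → 𝟙-cong suc-injective (cong suc) (suc i ≟ suc a) (i ≟ a))) (count-singleton a)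

∑-singleton-* : ∀ {n} (a : Fin n) c → ∑[ i < n ] (𝟙 (i ≟ a) * c) ≡ c
∑-singleton-* a c = trans (sym (*-distribʳ-sum c (λ i → 𝟙 (i ≟ a)))) (trans (cong (_* c) (count-singleton a)) (ℕ.*-identityˡ c))

count-unique : ∀ {n p} {P : Pred (Fin n) p} (P? : Decidable P) (a : Fin n) → P a →
               (∀ i j → P i → P j → i ≡ j) → count P? ≡ 1
count-unique P? a pa uniq =
  trans (sum-cong-≗ (λ i → 𝟙-cong (λ pᵢ → uniq i a pᵢ pa) (λ { refl → pa }) (P? i) (i ≟ a))) (count-singleton a)

module _ {n p q} {G : Pred (Fin n) p} (G? : Decidable G)
         {D : Rel (Fin n) q} (D? : Decidable₂ D) (D-sym : Symmetric D) (D-irrefl : ∀ {x} → ¬ D x x)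
         (one-partner : ∀ x → count (D? x) ≡ 𝟙 (G? x)) where

  private
    D<? : Decidable₂ (λ x y → D x y × x Fin.< y)
    D<? x y = D? x y ×-dec (x <ᶠ? y)

    split-by-order : ∀ x y → 𝟙 (D? x y) ≡ 𝟙 (D<? x y) + 𝟙 (D<? y x)
    split-by-order x y = 𝟙-⊎ (D? x y) (D<? x y) (D<? y x) by-order proj₁ (λ q → D-sym (proj₁ q))
                           (λ q r → <-asym (proj₂ q) (proj₂ r))
      where
      by-order : D x y → (D x y × x Fin.< y) ⊎ (D y x × y Fin.< x)
      by-order d with <-cmp x y
      ... | tri< x<y _ _ = inj₁ (d , x<y)
      ... | tri≈ _ refl _ = ⊥-elim (D-irrefl d)
      ... | tri> _ _ y<x = inj₂ (D-sym d , y<x)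

  count-even-if-matched : ∃ λ s → count G? ≡ s + s
  count-even-if-matched = s , (begin
    count G?
      ≡⟨ sum-cong-≗ (λ x → sym (one-partner x)) ⟩
    ∑[ x < n ] ∑[ y < n ] 𝟙 (D? x y)
      ≡⟨ sum-cong-≗ (λ x → trans (sum-cong-≗ (split-by-order x)) (∑-distrib-+ (λ y → 𝟙 (D<? x y)) (λ y → 𝟙 (D<? y x)))) ⟩
    ∑[ x < n ] (∑[ y < n ] 𝟙 (D<? x y) + ∑[ y < n ] 𝟙 (D<? y x))
      ≡⟨ ∑-distrib-+ (λ x → ∑[ y < n ] 𝟙 (D<? x y)) (λ x → ∑[ y < n ] 𝟙 (D<? y x)) ⟩
    s + ∑[ x < n ] ∑[ y < n ] 𝟙 (D<? y x)
      ≡⟨ cong (s +_) (∑-comm (λ x y → 𝟙 (D<? y x))) ⟩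
    s + s ∎)
    where
    open ≡-Reasoning
    s : ℕ
    s = ∑[ x < n ] ∑[ y < n ] 𝟙 (D<? x y)

count-partition : ∀ {n p q r} {P : Pred (Fin n) p} {Q : Pred (Fin n) q} {R : Pred (Fin n) r}
                  (P? : Decidable P) (Q? : Decidable Q) (R? : Decidable R) →
                  (∀ {i} → P i → Q i ⊎ R i) → (∀ {i} → Q i → P i) → (∀ {i} → R i → P i) → (∀ {i} → Q i → ¬ R i) →
                  count P? ≡ count Q? + count R?
count-partition P? Q? R? split Q⇒P R⇒P disjoint =
  trans (sum-cong-≗ (λ i → 𝟙-⊎ (P? i) (Q? i) (R? i) split Q⇒P R⇒P disjoint)) (∑-distrib-+ (λ i → 𝟙 (Q? i)) (λ i → 𝟙 (R? i)))

count-≥2 : ∀ {n p} {P : Pred (Fin n) p} (P? : Decidable P) {a b : Fin n} → P a → P b → a ≢ b → 2 ≤ count P?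
count-≥2 {n} P? {a} {b} pa pb a≢b = begin
  2                                       ≡⟨ sym (cong₂ _+_ (count-singleton a) (count-singleton b)) ⟩
  count (_≟ a) + count (_≟ b)             ≡⟨ sym (∑-distrib-+ (λ i → 𝟙 (i ≟ a)) (λ i → 𝟙 (i ≟ b))) ⟩
  ∑[ i < n ] (𝟙 (i ≟ a) + 𝟙 (i ≟ b))      ≤⟨ ∑-mono-≤ pointwise ⟩
  count P?                                ∎
  where
  open ℕ.≤-Reasoning
  pointwise : ∀ i → 𝟙 (i ≟ a) + 𝟙 (i ≟ b) ≤ 𝟙 (P? i)
  pointwise i with i ≟ a | i ≟ b
  ... | yes refl | yes refl = ⊥-elim (a≢b refl)
  ... | yes refl | no _     = ℕ.≤-reflexive (sym (𝟙-yes pa (P? i)))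
  ... | no _     | yes refl = ℕ.≤-reflexive (sym (𝟙-yes pb (P? i)))
  ... | no _     | no _     = z≤n

module _ {n j p} {S : Pred (Fin n) p} (S? : Decidable S) (h : Fin n → Fin j) where

  fibre? : (c : Fin j) → Decidable (λ x → S x × h x ≡ c)
  fibre? c x = S? x ×-dec (h x ≟ c)

  count-fibres : count S? ≡ ∑[ c < j ] count (fibre? c)
  count-fibres = trans (sym (sum-cong-≗ fibres-of-point)) (∑-comm (λ x c → 𝟙 (fibre? c x)))
    where
    fibres-of-point : ∀ x → ∑[ c < j ] 𝟙 (fibre? c x) ≡ 𝟙 (S? x)
    fibres-of-point x = go (S? x)
      where
      go : (sx? : Dec (S x)) → ∑[ c < j ] 𝟙 (sx? ×-dec (h x ≟ c)) ≡ 𝟙 sx?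
      go sx?@(yes sx) = count-unique (λ c → sx? ×-dec (h x ≟ c)) (h x) (sx , refl) (λ c d p q → trans (sym (proj₂ p)) (proj₂ q))
      go sx?@(no ¬sx) = count-none (λ c → sx? ×-dec (h x ≟ c)) (λ c p → ¬sx (proj₁ p))

  module _ (h-inj : ∀ x y → S x → S y → h x ≡ h y → x ≡ y) where

    count-fibre-≤1 : ∀ c → count (fibre? c) ≤ 1
    count-fibre-≤1 c = count-≤1 (fibre? c) (λ x y p q → h-inj x y (proj₁ p) (proj₁ q) (trans (proj₂ p) (sym (proj₂ q))))

    count-≤-injective : count S? ≤ j
    count-≤-injective = begin
      count S?                      ≡⟨ count-fibres ⟩
      ∑[ c < j ] count (fibre? c)   ≤⟨ ∑-mono-≤ count-fibre-≤1 ⟩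
      ∑[ c < j ] 1                  ≡⟨ ∑-one j ⟩
      j                             ∎
      where open ℕ.≤-Reasoning

    count-<-injective-avoiding : (δ : Fin j) → (∀ x → S x → h x ≢ δ) → count S? < j
    count-<-injective-avoiding δ avoid = begin
      suc (count S?)                                       ≡⟨ cong₂ _+_ (sym (count-singleton δ)) count-fibres ⟩
      count (_≟ δ) + ∑[ c < j ] count (fibre? c)           ≡⟨ sym (∑-distrib-+ (λ c → 𝟙 (c ≟ δ)) (λ c → count (fibre? c))) ⟩
      ∑[ c < j ] (𝟙 (c ≟ δ) + count (fibre? c))            ≤⟨ ∑-mono-≤ at-most-one ⟩
      ∑[ c < j ] 1                                         ≡⟨ ∑-one j ⟩
      j                                                    ∎
      where
      open ℕ.≤-Reasoning
      at-most-one : ∀ c → 𝟙 (c ≟ δ) + count (fibre? c) ≤ 1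
      at-most-one c with c ≟ δ
      ... | yes refl = ℕ.≤-reflexive (cong suc (count-none (fibre? c) (λ x p → avoid x (proj₁ p) (proj₂ p))))
      ... | no _     = count-fibre-≤1 c

  injective-if-fibres-inhabited : count S? ≡ j → (∀ c → 1 ≤ count (fibre? c)) →
                                  ∀ x y → S x → S y → h x ≡ h y → x ≡ y
  injective-if-fibres-inhabited |S|≡j inhabited x y sx sy hx≡hy with x ≟ y
  ... | yes x≡y = x≡y
  ... | no x≢y  = ⊥-elim (ℕ.<-irrefl refl (begin
    suc j                                     ≡⟨ cong₂ _+_ (sym (count-singleton (h x))) (sym (∑-one j)) ⟩
    count (_≟ h x) + ∑[ c < j ] 1             ≡⟨ sym (∑-distrib-+ (λ c → 𝟙 (c ≟ h x)) (λ _ → 1)) ⟩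
    ∑[ c < j ] (𝟙 (c ≟ h x) + 1)              ≤⟨ ∑-mono-≤ pointwise ⟩
    ∑[ c < j ] count (fibre? c)               ≡⟨ sym count-fibres ⟩
    count S?                                  ≡⟨ |S|≡j ⟩
    j                                         ∎))
    where
    open ℕ.≤-Reasoning
    pointwise : ∀ c → 𝟙 (c ≟ h x) + 1 ≤ count (fibre? c)
    pointwise c with c ≟ h x
    ... | yes refl = count-≥2 (fibre? c) (sx , refl) (sy , sym hx≡hy) x≢y
    ... | no _     = inhabited c

∑ˡ : {A : Set} → List A → (A → ℕ) → ℕ
∑ˡ []       f = 0
∑ˡ (x ∷ xs) f = f x + ∑ˡ xs f

module _ {A : Set} where

  length-filter : ∀ {p} {P : Pred A p} (P? : Decidable P) xs → length (filter P? xs) ≡ ∑ˡ xs (λ x → 𝟙 (P? x))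
  length-filter P? []       = refl
  length-filter P? (x ∷ xs) with P? x
  ... | yes _ = cong suc (length-filter P? xs)
  ... | no _  = length-filter P? xs

  ∑ˡ-filter : ∀ {p} {P : Pred A p} (P? : Decidable P) xs (f : A → ℕ) → ∑ˡ (filter P? xs) f ≡ ∑ˡ xs (λ x → 𝟙 (P? x) * f x)
  ∑ˡ-filter P? []       f = refl
  ∑ˡ-filter P? (x ∷ xs) f with P? x
  ... | yes _ = cong₂ _+_ (sym (ℕ.+-identityʳ (f x))) (∑ˡ-filter P? xs f)
  ... | no _  = ∑ˡ-filter P? xs f

  ∑ˡ-++ : ∀ xs ys (f : A → ℕ) → ∑ˡ (xs ++ ys) f ≡ ∑ˡ xs f + ∑ˡ ys f
  ∑ˡ-++ []       ys f = refl
  ∑ˡ-++ (x ∷ xs) ys f = trans (cong (f x +_) (∑ˡ-++ xs ys f)) (sym (ℕ.+-assoc (f x) _ _))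

  ∑ˡ-map : ∀ {B : Set} (g : B → A) xs (f : A → ℕ) → ∑ˡ (map g xs) f ≡ ∑ˡ xs (λ x → f (g x))
  ∑ˡ-map g []       f = refl
  ∑ˡ-map g (x ∷ xs) f = cong (f (g x) +_) (∑ˡ-map g xs f)

  ∑ˡ-concat : ∀ xss (f : A → ℕ) → ∑ˡ (concat xss) f ≡ ∑ˡ xss (λ xs → ∑ˡ xs f)
  ∑ˡ-concat []         f = refl
  ∑ˡ-concat (xs ∷ xss) f = trans (∑ˡ-++ xs (concat xss) f) (cong (∑ˡ xs f +_) (∑ˡ-concat xss f))

  ∑ˡ-lookup : ∀ xs (f : A → ℕ) → ∑ˡ xs f ≡ ∑[ i < length xs ] f (lookup xs i)
  ∑ˡ-lookup []       f = refl
  ∑ˡ-lookup (x ∷ xs) f = cong (f x +_) (∑ˡ-lookup xs f)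

  lookup-injective : ∀ {xs : List A} → Unique xs → ∀ i j → lookup xs i ≡ lookup xs j → i ≡ j
  lookup-injective (_ ∷ _)  zero    zero    _  = refl
  lookup-injective (x∉ ∷ _) zero    (suc j) eq = ⊥-elim (All.lookup x∉ (∈-lookup j) eq)
  lookup-injective u@(_ ∷ _) (suc i) zero eq = sym (lookup-injective u zero (suc i) (sym eq))
  lookup-injective (_ ∷ u)  (suc i) (suc j) eq = cong suc (lookup-injective u i j eq)

∑ˡ-tabulate : ∀ {A : Set} {n} (g : Fin n → A) (f : A → ℕ) → ∑ˡ (tabulate g) f ≡ ∑[ i < n ] f (g i)
∑ˡ-tabulate {n = zero}  g f = refl
∑ˡ-tabulate {n = suc n} g f = cong (f (g zero) +_) (∑ˡ-tabulate (λ i → g (suc i)) f)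

∑ˡ-allFin : ∀ n (f : Fin n → ℕ) → ∑ˡ (allFin n) f ≡ sum f
∑ˡ-allFin n = ∑ˡ-tabulate (λ i → i)

concatMap-pairs≡cartesianProduct : ∀ {A B : Set} (xs : List A) (ys : List B) →
                                   concatMap (λ a → map (λ b → a , b) ys) xs ≡ cartesianProduct xs ys
concatMap-pairs≡cartesianProduct []       ys = refl
concatMap-pairs≡cartesianProduct (x ∷ xs) ys = cong (map (x ,_) ys ++_) (concatMap-pairs≡cartesianProduct xs ys)

∑ˡ-pairs : ∀ n (g : Fin n × Fin n → ℕ) →
           ∑ˡ (concatMap (λ a → map (λ b → a , b) (allFin n)) (allFin n)) g ≡ ∑[ a < n ] ∑[ b < n ] g (a , b)
∑ˡ-pairs n g = begin
  ∑ˡ (concat (map row (allFin n))) g                      ≡⟨ ∑ˡ-concat (map row (allFin n)) g ⟩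
  ∑ˡ (map row (allFin n)) (λ xs → ∑ˡ xs g)                ≡⟨ ∑ˡ-map row (allFin n) (λ xs → ∑ˡ xs g) ⟩
  ∑ˡ (allFin n) (λ a → ∑ˡ (row a) g)                      ≡⟨ ∑ˡ-allFin n (λ a → ∑ˡ (row a) g) ⟩
  ∑[ a < n ] ∑ˡ (row a) g                                 ≡⟨ sum-cong-≗ (λ a → ∑ˡ-map (a ,_) (allFin n) g) ⟩
  ∑[ a < n ] ∑ˡ (allFin n) (λ b → g (a , b))              ≡⟨ sum-cong-≗ (λ a → ∑ˡ-allFin n (λ b → g (a , b))) ⟩
  ∑[ a < n ] ∑[ b < n ] g (a , b)                         ∎
  where
  open ≡-Reasoning
  row : Fin n → List (Fin n × Fin n)
  row a = map (λ b → a , b) (allFin n)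

∑-↑ : ∀ m {n} (f : Fin (m + n) → ℕ) → sum f ≡ ∑[ i < m ] f (i ↑ˡ n) + ∑[ i < n ] f (m ↑ʳ i)
∑-↑ zero    f = refl
∑-↑ (suc m) f = trans (cong (f zero +_) (∑-↑ m (λ i → f (suc i)))) (sym (ℕ.+-assoc (f zero) _ _))

∑-combine : ∀ m {n} (f : Fin (m * n) → ℕ) → sum f ≡ ∑[ i < m ] ∑[ j < n ] f (combine i j)
∑-combine zero    f = refl
∑-combine (suc m) {n} f = trans (∑-↑ n f) (cong (∑[ j < n ] f (j ↑ˡ (m * n)) +_) (∑-combine m (λ i → f (n ↑ʳ i))))

%-cancelˡ-+ : ∀ d .{{_ : NonZero d}} p a b → (p + a) % d ≡ (p + b) % d → a % d ≡ b % d
%-cancelˡ-+ d p a b eq = begin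
  a % d                                   ≡⟨ shift a ⟩
  ((p + a) + (d ∸ p % d)) % d             ≡⟨ %-distribˡ-+ (p + a) _ d ⟩
  ((p + a) % d + (d ∸ p % d) % d) % d     ≡⟨ cong (λ t → (t + (d ∸ p % d) % d) % d) eq ⟩
  ((p + b) % d + (d ∸ p % d) % d) % d     ≡⟨ sym (%-distribˡ-+ (p + b) _ d) ⟩
  ((p + b) + (d ∸ p % d)) % d             ≡⟨ sym (shift b) ⟩
  b % d                                   ∎
  where
  open ≡-Reasoning
  -- d ∸ p % d completes p to a multiple of d
  shift : ∀ a → a % d ≡ ((p + a) + (d ∸ p % d)) % d
  shift a = begin
    a % d
      ≡⟨ sym ([m+n]%n≡m%n a d) ⟩
    (a + d) % d
      ≡⟨ sym ([m+kn]%n≡m%n (a + d) (p / d) d) ⟩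
    ((a + d) + p / d * d) % d
      ≡⟨ cong (λ t → ((a + t) + p / d * d) % d) (sym (ℕ.m+[n∸m]≡n (ℕ.<⇒≤ (m%n<n p d)))) ⟩
    ((a + (p % d + (d ∸ p % d))) + p / d * d) % d
      ≡⟨ cong (_% d) (solve 4 (λ a r s q → (a :+ (r :+ s)) :+ q := ((r :+ q) :+ a) :+ s) refl a (p % d) (d ∸ p % d) (p / d * d)) ⟩
    ((p % d + p / d * d + a) + (d ∸ p % d)) % d
      ≡⟨ cong (λ t → ((t + a) + (d ∸ p % d)) % d) (sym (m≡m%n+[m/n]*n p d)) ⟩
    ((p + a) + (d ∸ p % d)) % d ∎

-- Halving modulo K = 2j + 1 is multiplication by j + 1, as 2(j + 1) ≡ 1 (mod K).
module Midpoint (j : ℕ) where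

  K : ℕ
  K = suc (j + j)

  half : Fin K → ℕ
  half g = (toℕ g * suc j) % K

  half-double : ∀ g → (half g + half g) % K ≡ toℕ g
  half-double g = begin
    (half g + half g) % K       ≡⟨ sym (%-distribˡ-+ x x K) ⟩
    (x + x) % K                 ≡⟨ cong (_% K) (solve 2 (λ t j → t :* (con 1 :+ j) :+ t :* (con 1 :+ j) := t :+ t :* (con 1 :+ (j :+ j)))
                                                        refl (toℕ g) j) ⟩
    (toℕ g + toℕ g * K) % K     ≡⟨ [m+kn]%n≡m%n (toℕ g) (toℕ g) K ⟩
    toℕ g % K                   ≡⟨ m<n⇒m%n≡m (toℕ<n g) ⟩
    toℕ g                       ∎
    where
    open ≡-Reasoning
    x : ℕ
    x = toℕ g * suc j

  half-injective : ∀ a b → half a % K ≡ half b % K → a ≡ b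
  half-injective a b eq = toℕ-injective (begin
    toℕ a                   ≡⟨ sym (half-double a) ⟩
    (half a + half a) % K   ≡⟨ cong (λ t → (t + t) % K) half-a≡half-b ⟩
    (half b + half b) % K   ≡⟨ half-double b ⟩
    toℕ b                   ∎)
    where
    open ≡-Reasoning
    half-a≡half-b : half a ≡ half b
    half-a≡half-b = trans (sym (m<n⇒m%n≡m (m%n<n (toℕ a * suc j) K))) (trans eq (m<n⇒m%n≡m (m%n<n (toℕ b * suc j) K)))

  midpoint : Fin K → Fin K → Fin K
  midpoint g a = (half g + half a) mod K

  toℕ-midpoint : ∀ g a → toℕ (midpoint g a) ≡ (half g + half a) % K
  toℕ-midpoint g a = toℕ-fromℕ< (m%n<n (half g + half a) K)

  midpoint-comm : ∀ g a → midpoint g a ≡ midpoint a g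
  midpoint-comm g a = cong (_mod K) (ℕ.+-comm (half g) (half a))

  midpoint-injectiveʳ : ∀ g a b → midpoint g a ≡ midpoint g b → a ≡ b
  midpoint-injectiveʳ g a b eq = half-injective a b (%-cancelˡ-+ K (half g) (half a) (half b)
    (trans (sym (toℕ-midpoint g a)) (trans (cong toℕ eq) (toℕ-midpoint g b))))

  midpoint≡ˡ⇒≡ : ∀ g a → midpoint g a ≡ g → a ≡ g
  midpoint≡ˡ⇒≡ g a eq = half-injective a g (%-cancelˡ-+ K (half g) (half a) (half g)
    (trans (sym (toℕ-midpoint g a)) (trans (cong toℕ eq) (sym (half-double g)))))

m+m≢suc[n+n] : ∀ s j → s + s ≢ suc (j + j)
m+m≢suc[n+n] s j e =
  ℕ.even≢odd s j (trans (cong (s +_) (ℕ.+-identityʳ s)) (trans e (cong (λ t → suc (j + t)) (sym (ℕ.+-identityʳ j)))))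

-- L spans a complete graph with a pendant edge at each vertex; κ x y is the colour of
-- the edge xy and γ x that of the pendant edge at x.
module PendantColouring {N k ℓ} {L : Pred (Fin N) ℓ} (L? : Decidable L) (|L|≡k : count L? ≡ k)
  (γ : Fin N → Fin k) (κ : Fin N → Fin N → Fin k)
  (κ-sym : ∀ {x y} → L x → L y → x ≢ y → κ x y ≡ κ y x)
  (κ≢γ : ∀ {x y} → L x → L y → x ≢ y → κ x y ≢ γ x)
  (κ-proper : ∀ {x y z} → L x → L y → L z → x ≢ y → x ≢ z → y ≢ z → κ x y ≢ κ x z) where

  -- the pendant edge at x stands in for the missing edge xx
  colourAt : Fin N → Fin N → Fin k
  colourAt x y with x ≟ y
  ... | yes _ = γ x
  ... | no _  = κ x y

  colourAt-injective : ∀ {x} → L x → ∀ y z → L y → L z → colourAt x y ≡ colourAt x z → y ≡ z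
  colourAt-injective {x} lx y z ly lz eq with y ≟ z
  ... | yes y≡z = y≡z
  ... | no y≢z with x ≟ y | x ≟ z
  ... | yes refl | yes refl = ⊥-elim (y≢z refl)
  ... | yes refl | no x≢z   = ⊥-elim (κ≢γ lx lz x≢z (sym eq))
  ... | no x≢y   | yes refl = ⊥-elim (κ≢γ lx ly x≢y eq)
  ... | no x≢y   | no x≢z   = ⊥-elim (κ-proper lx ly lz x≢y x≢z y≢z eq)

  colourAt-surjective : ∀ {x} → L x → ∀ δ → ∃ λ y → L y × colourAt x y ≡ δ
  colourAt-surjective {x} lx δ with any? (λ y → L? y ×-dec (colourAt x y ≟ δ))
  ... | yes found = found
  ... | no ∄      = ⊥-elim (ℕ.<-irrefl refl (subst (_< k) |L|≡k
                      (count-<-injective-avoiding L? (colourAt x) (colourAt-injective lx) δ (λ y ly e → ∄ (y , ly , e)))))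

  module _ (δ : Fin k) where

    Partner : Fin N → Fin N → Set ℓ
    Partner x y = L x × L y × x ≢ y × κ x y ≡ δ

    Partner? : ∀ x y → Dec (Partner x y)
    Partner? x y = L? x ×-dec L? y ×-dec ¬? (x ≟ y) ×-dec (κ x y ≟ δ)

    Misses? : Decidable (λ x → L x × γ x ≢ δ)
    Misses? x = L? x ×-dec ¬? (γ x ≟ δ)

    Hits? : Decidable (λ x → L x × γ x ≡ δ)
    Hits? x = fibre? L? γ δ x

    partner-unique : ∀ {x y z} → Partner x y → Partner x z → y ≡ z
    partner-unique {x} {y} {z} (lx , ly , x≢y , κxy≡δ) (_ , lz , x≢z , κxz≡δ) with y ≟ z
    ... | yes y≡z = y≡z
    ... | no y≢z  = ⊥-elim (κ-proper lx ly lz x≢y x≢z y≢z (trans κxy≡δ (sym κxz≡δ)))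

    partner-exists : ∀ {x} → L x → γ x ≢ δ → ∃ (Partner x)
    partner-exists {x} lx γx≢δ with colourAt-surjective lx δ
    ... | y , ly , eq with x ≟ y
    ...   | yes refl = ⊥-elim (γx≢δ eq)
    ...   | no x≢y   = y , lx , ly , x≢y , eq

    partner-count : ∀ x → count (Partner? x) ≡ 𝟙 (Misses? x)
    partner-count x = go (L? x) (γ x ≟ δ)
      where
      go : Dec (L x) → Dec (γ x ≡ δ) → count (Partner? x) ≡ 𝟙 (Misses? x)
      go (no ¬lx) _ = trans (count-none (Partner? x) (λ y p → ¬lx (proj₁ p))) (sym (𝟙-no (λ m → ¬lx (proj₁ m)) (Misses? x)))
      go (yes lx) (yes γx≡δ) =
        trans (count-none (Partner? x) (λ { y (_ , ly , x≢y , κxy≡δ) → κ≢γ lx ly x≢y (trans κxy≡δ (sym γx≡δ)) }))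
              (sym (𝟙-no (λ m → proj₂ m γx≡δ) (Misses? x)))
      go (yes lx) (no γx≢δ) with partner-exists lx γx≢δ
      ... | y , p = trans (count-unique (Partner? x) y p (λ z w pz pw → trans (sym (partner-unique p pz)) (partner-unique p pw)))
                          (sym (𝟙-yes (lx , γx≢δ) (Misses? x)))

    partner-sym : ∀ {x y} → Partner x y → Partner y x
    partner-sym (lx , ly , x≢y , κxy≡δ) = ly , lx , ≢-sym x≢y , trans (sym (κ-sym lx ly x≢y)) κxy≡δ

    misses-even : ∃ λ s → count Misses? ≡ s + s
    misses-even = count-even-if-matched Misses? Partner? partner-sym (λ p → proj₁ (proj₂ (proj₂ p)) refl) partner-count

    misses+hits : count Misses? + count Hits? ≡ k
    misses+hits = trans (sym (count-partition L? Misses? Hits? misses-or-hits proj₁ proj₁ (λ m h → proj₂ m (proj₂ h)))) |L|≡k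
      where
      misses-or-hits : ∀ {x} → L x → (L x × γ x ≢ δ) ⊎ (L x × γ x ≡ δ)
      misses-or-hits {x} lx with γ x ≟ δ
      ... | yes γx≡δ = inj₂ (lx , γx≡δ)
      ... | no γx≢δ  = inj₁ (lx , γx≢δ)

    hits-inhabited : Odd k → 1 ≤ count Hits?
    hits-inhabited (j , k≡2j+1) with misses-even | count Hits? in hits≡
    ... | _             | suc _ = s≤s z≤n
    ... | s , misses≡2s | zero  = ⊥-elim (m+m≢suc[n+n] s j (begin
      s + s                       ≡⟨ sym misses≡2s ⟩
      count Misses?               ≡⟨ sym (ℕ.+-identityʳ _) ⟩
      count Misses? + 0           ≡⟨ cong (count Misses? +_) (sym hits≡) ⟩
      count Misses? + count Hits? ≡⟨ misses+hits ⟩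
      k                           ≡⟨ k≡2j+1 ⟩
      suc (j + j)                 ∎))
      where open ≡-Reasoning

  pendant-colours-injective : Odd k → ∀ x y → L x → L y → γ x ≡ γ y → x ≡ y
  pendant-colours-injective k-odd = injective-if-fibres-inhabited L? γ |L|≡k (λ δ → hits-inhabited δ k-odd)

Incident : ∀ {V} → Fin V → Fin V × Fin V → Set
Incident v uv = proj₁ uv ≡ v ⊎ proj₂ uv ≡ v

Incident? : ∀ {V} (v : Fin V) → Decidable (Incident v)
Incident? v uv = (proj₁ uv ≟ v) ⊎-dec (proj₂ uv ≟ v)

increasing-pair-unique : ∀ {V} {p q : Fin V × Fin V} {z w} →
  toℕ (proj₁ p) < toℕ (proj₂ p) → toℕ (proj₁ q) < toℕ (proj₂ q) → z ≢ w →
  Incident z p → Incident w p → Incident z q → Incident w q → p ≡ q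
increasing-pair-unique p< q< z≢w (inj₁ refl) (inj₁ refl) _ _ = ⊥-elim (z≢w refl)
increasing-pair-unique p< q< z≢w (inj₂ refl) (inj₂ refl) _ _ = ⊥-elim (z≢w refl)
increasing-pair-unique p< q< z≢w _ _ (inj₁ refl) (inj₁ refl) = ⊥-elim (z≢w refl)
increasing-pair-unique p< q< z≢w _ _ (inj₂ refl) (inj₂ refl) = ⊥-elim (z≢w refl)
increasing-pair-unique p< q< z≢w (inj₁ refl) (inj₂ refl) (inj₁ refl) (inj₂ refl) = refl
increasing-pair-unique p< q< z≢w (inj₂ refl) (inj₁ refl) (inj₂ refl) (inj₁ refl) = refl
increasing-pair-unique p< q< z≢w (inj₁ refl) (inj₂ refl) (inj₂ refl) (inj₁ refl) = ⊥-elim (ℕ.<-asym p< q<)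
increasing-pair-unique p< q< z≢w (inj₂ refl) (inj₁ refl) (inj₁ refl) (inj₂ refl) = ⊥-elim (ℕ.<-asym p< q<)

pair-has-two-ends : ∀ {V} {p : Fin V × Fin V} {x y z} → Incident x p → Incident y p → Incident z p →
                    x ≡ y ⊎ x ≡ z ⊎ y ≡ z
pair-has-two-ends (inj₁ refl) (inj₁ refl) _           = inj₁ refl
pair-has-two-ends (inj₂ refl) (inj₂ refl) _           = inj₁ refl
pair-has-two-ends (inj₁ refl) (inj₂ refl) (inj₁ refl) = inj₂ (inj₁ refl)
pair-has-two-ends (inj₁ refl) (inj₂ refl) (inj₂ refl) = inj₂ (inj₂ refl)
pair-has-two-ends (inj₂ refl) (inj₁ refl) (inj₁ refl) = inj₂ (inj₂ refl)
pair-has-two-ends (inj₂ refl) (inj₁ refl) (inj₂ refl) = inj₂ (inj₁ refl)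

ShareEnd-intro : ∀ {V} {p q : Fin V × Fin V} {v} → Incident v p → Incident v q → ShareEnd p q
ShareEnd-intro (inj₁ refl) (inj₁ refl) = inj₁ (inj₁ refl)
ShareEnd-intro (inj₁ refl) (inj₂ refl) = inj₁ (inj₂ refl)
ShareEnd-intro (inj₂ refl) (inj₁ refl) = inj₂ (inj₁ refl)
ShareEnd-intro (inj₂ refl) (inj₂ refl) = inj₂ (inj₂ refl)

ShareEnd-elim : ∀ {V} {p q : Fin V × Fin V} → ShareEnd p q → ∃ λ v → Incident v p × Incident v q
ShareEnd-elim {p = a , b} (inj₁ (inj₁ a≡c)) = a , inj₁ refl , inj₁ (sym a≡c)
ShareEnd-elim {p = a , b} (inj₁ (inj₂ a≡d)) = a , inj₁ refl , inj₂ (sym a≡d)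
ShareEnd-elim {p = a , b} (inj₂ (inj₁ b≡c)) = b , inj₂ refl , inj₁ (sym b≡c)
ShareEnd-elim {p = a , b} (inj₂ (inj₂ b≡d)) = b , inj₂ refl , inj₂ (sym b≡d)

valency≡count : (G : Multigraph) (v : Fin (n G)) → valency G v ≡ count (λ e → Incident? v (ends G e))
valency≡count G v = trans (length-filter (Incident? v) (edges G)) (∑ˡ-lookup (edges G) (λ uv → 𝟙 (Incident? v uv)))

valency≤colours : (G : Multigraph) {j : ℕ} → EdgeColourable G j → ∀ v → valency G v ≤ j
valency≤colours G (c , proper) v = subst (_≤ _) (sym (valency≡count G v))
  (count-≤-injective (λ e → Incident? v (ends G e)) c c-injective)
  where
  c-injective : ∀ e f → Incident v (ends G e) → Incident v (ends G f) → c e ≡ c f → e ≡ f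
  c-injective e f e∋v f∋v ce≡cf with e ≟ f
  ... | yes e≡f = e≡f
  ... | no e≢f  = ⊥-elim (proper e f e≢f (ShareEnd-intro e∋v f∋v) ce≡cf)

foldr-⊔-upper : ∀ {x xs} → x ∈ xs → x ≤ foldr _⊔_ 0 xs
foldr-⊔-upper {xs = y ∷ ys} (here refl) = ℕ.m≤m⊔n y _
foldr-⊔-upper {xs = y ∷ ys} (there x∈ys) = ℕ.m≤n⇒m≤o⊔n y (foldr-⊔-upper x∈ys)

valency≤maxValency : (G : Multigraph) → ∀ v → valency G v ≤ maxValency G
valency≤maxValency G v = foldr-⊔-upper (∈-map⁺ (valency G) (∈-allFin v))

maxValency-lub : (G : Multigraph) {j : ℕ} → (∀ v → valency G v ≤ j) → maxValency G ≤ j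
maxValency-lub G {j} bound = foldr-preservesᵇ {P = _≤ j} ℕ.⊔-lub z≤n (All.map⁺ (All.tabulate⁺ bound))

maxValency-regular : (G : Multigraph) {k : ℕ} → Regular G k → Fin (n G) → maxValency G ≡ k
maxValency-regular G regular v = ℕ.≤-antisym (maxValency-lub G (λ w → ℕ.≤-reflexive (regular w)))
                                             (subst (_≤ maxValency G) (regular v) (valency≤maxValency G v))

ClassI⇔colourable : (G : Multigraph) → ClassI G ⇔ EdgeColourable G (maxValency G)
ClassI⇔colourable G = mk⇔ proj₁ (λ c → c , λ j cⱼ → maxValency-lub G (valency≤colours G cⱼ))

ClassI⇔colourable-regular : (G : Multigraph) {k : ℕ} → Regular G k → Fin (n G) → ClassI G ⇔ EdgeColourable G k
ClassI⇔colourable-regular G regular v = subst (λ j → ClassI G ⇔ EdgeColourable G j) (maxValency-regular G regular v) (ClassI⇔colourable G)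

ClassI-edgeless : ∀ V → ClassI (mkGraph V [])
ClassI-edgeless V = Equivalence.from (ClassI⇔colourable (mkGraph V [])) ((λ ()) , (λ ()))

module Truncation (X : Multigraph) where

  m : ℕ
  m = length (edges X)

  N : ℕ
  N = m * 2

  T : Multigraph
  T = completeTruncation X

  label : Fin N → Fin (n X)
  label = endLabel X

  edgeOf : Fin N → Fin m
  edgeOf x = proj₁ (remQuot {m} 2 x)

  side : Fin N → Fin 2
  side x = proj₂ (remQuot {m} 2 x)

  ≡-combine : ∀ x → x ≡ combine (edgeOf x) (side x)
  ≡-combine x = sym (combine-remQuot {m} 2 x)

  edgeOf-combine : ∀ e i → edgeOf (combine e i) ≡ e
  edgeOf-combine e i = cong proj₁ (remQuot-combine {m} {2} e i)

  endpoint : Fin m → Fin 2 → Fin (n X)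
  endpoint e zero       = proj₁ (ends X e)
  endpoint e (suc zero) = proj₂ (ends X e)

  label-combine : ∀ e i → label (combine e i) ≡ endpoint e i
  label-combine e zero       rewrite remQuot-combine {m} {2} e zero       = refl
  label-combine e (suc zero) rewrite remQuot-combine {m} {2} e (suc zero) = refl

  label≡endpoint : ∀ x → label x ≡ endpoint (edgeOf x) (side x)
  label≡endpoint x = trans (cong label (≡-combine x)) (label-combine (edgeOf x) (side x))

  end-labelled : ∀ {e w} → Incident w (ends X e) → ∃ λ a → edgeOf a ≡ e × label a ≡ w
  end-labelled {e} (inj₁ p) = combine e zero       , edgeOf-combine e zero       , trans (label-combine e zero) p
  end-labelled {e} (inj₂ p) = combine e (suc zero) , edgeOf-combine e (suc zero) , trans (label-combine e (suc zero)) p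

  matchingPair : Fin m → Fin N × Fin N
  matchingPair e = combine e zero , combine e (suc zero)

  Incident-matchingPair : ∀ {e x} → Incident x (matchingPair e) → edgeOf x ≡ e
  Incident-matchingPair {e} (inj₁ refl) = edgeOf-combine e zero
  Incident-matchingPair {e} (inj₂ refl) = edgeOf-combine e (suc zero)

  Incident-matchingPair-edgeOf : ∀ x → Incident x (matchingPair (edgeOf x))
  Incident-matchingPair-edgeOf x = go (side x) (sym (≡-combine x))
    where
    go : ∀ i → combine (edgeOf x) i ≡ x → Incident x (matchingPair (edgeOf x))
    go zero       eq = inj₁ eq
    go (suc zero) eq = inj₂ eq

  CliquePair : Fin N × Fin N → Set
  CliquePair ab = toℕ (proj₁ ab) < toℕ (proj₂ ab) × label (proj₁ ab) ≡ label (proj₂ ab)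

  CliquePair? : Decidable CliquePair
  CliquePair? ab = (toℕ (proj₁ ab) ℕ.<? toℕ (proj₂ ab)) ×-dec (label (proj₁ ab) ≟ label (proj₂ ab))

  allPairs : List (Fin N × Fin N)
  allPairs = concatMap (λ a → map (λ b → a , b) (allEnds X)) (allEnds X)

  private
    ∈-allPairs : ∀ a b → (a , b) ∈ allPairs
    ∈-allPairs a b = subst ((a , b) ∈_) (sym (concatMap-pairs≡cartesianProduct (allEnds X) (allEnds X)))
                       (∈-cartesianProduct⁺ (∈-allFin a) (∈-allFin b))

    ∈-matchingEdges : ∀ e → matchingPair e ∈ edges T
    ∈-matchingEdges e = ∈-++⁺ˡ (∈-map⁺ matchingPair (∈-allFin e))

    ∈-cliqueEdges : ∀ a b → CliquePair (a , b) → (a , b) ∈ edges T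
    ∈-cliqueEdges a b q = ∈-++⁺ʳ (matchingEdges X) (∈-filter⁺ CliquePair? (∈-allPairs a b) q)

  matchingEdge : Fin m → Edge T
  matchingEdge e = index (∈-matchingEdges e)

  ends-matchingEdge : ∀ e → ends T (matchingEdge e) ≡ matchingPair e
  ends-matchingEdge e = sym (lookup-index (∈-matchingEdges e))

  cliqueEdge : ∀ a b → CliquePair (a , b) → Edge T
  cliqueEdge a b q = index (∈-cliqueEdges a b q)

  ends-cliqueEdge : ∀ a b q → ends T (cliqueEdge a b q) ≡ (a , b)
  ends-cliqueEdge a b q = sym (lookup-index (∈-cliqueEdges a b q))

  MatchingOrClique : Fin N × Fin N → Set
  MatchingOrClique p = (∃ λ e → p ≡ matchingPair e) ⊎ CliquePair p

  CliqueEdgeBetween : Fin N → Fin N → Edge T → Set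
  CliqueEdgeBetween x y t = CliquePair (ends T t) × Incident x (ends T t) × Incident y (ends T t)

  CliqueEdgeBetween-sym : ∀ {x y t} → CliqueEdgeBetween x y t → CliqueEdgeBetween y x t
  CliqueEdgeBetween-sym (q , x∈t , y∈t) = q , y∈t , x∈t

  cliqueEdge-between : ∀ {a b} (q : CliquePair (a , b)) → CliqueEdgeBetween a b (cliqueEdge a b q)
  cliqueEdge-between {a} {b} q rewrite ends-cliqueEdge a b q = q , inj₁ refl , inj₂ refl

  matching-or-clique : ∀ t → MatchingOrClique (ends T t)
  matching-or-clique t with ∈-++⁻ (matchingEdges X) (∈-lookup {xs = edges T} t)
  ... | inj₁ ∈ms with ∈-map⁻ matchingPair ∈ms
  ...   | e , _ , eq = inj₁ (e , eq)
  matching-or-clique t | inj₂ ∈cs = inj₂ (proj₂ (∈-filter⁻ CliquePair? {xs = allPairs} ∈cs))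

  module _ (loopless : Loopless X) where

    no-loop : ∀ e → proj₁ (ends X e) ≢ proj₂ (ends X e)
    no-loop e = All.lookup loopless (∈-lookup e)

    endpoint-injective : ∀ e i j → endpoint e i ≡ endpoint e j → i ≡ j
    endpoint-injective e zero       zero       _  = refl
    endpoint-injective e zero       (suc zero) eq = ⊥-elim (no-loop e eq)
    endpoint-injective e (suc zero) zero       eq = ⊥-elim (no-loop e (sym eq))
    endpoint-injective e (suc zero) (suc zero) _  = refl

    ≡-from-edgeOf-label : ∀ {y z} → edgeOf y ≡ edgeOf z → label y ≡ label z → y ≡ z
    ≡-from-edgeOf-label {y} {z} e≡ l≡ = begin
      y                               ≡⟨ ≡-combine y ⟩
      combine (edgeOf y) (side y)     ≡⟨ cong₂ combine e≡ side≡ ⟩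
      combine (edgeOf z) (side z)     ≡⟨ sym (≡-combine z) ⟩
      z                               ∎
      where
      open ≡-Reasoning
      side≡ : side y ≡ side z
      side≡ = endpoint-injective (edgeOf z) (side y) (side z)
                (trans (cong (λ e → endpoint e (side y)) (sym e≡)) (trans (sym (label≡endpoint y)) (trans l≡ (label≡endpoint z))))

    Incident-label-edgeOf : ∀ y → Incident (label y) (ends X (edgeOf y))
    Incident-label-edgeOf y with side y | label≡endpoint y
    ... | zero     | eq = inj₁ (sym eq)
    ... | suc zero | eq = inj₂ (sym eq)

    CliquePair⇒edgeOf≢ : ∀ {a b} → CliquePair (a , b) → edgeOf a ≢ edgeOf b
    CliquePair⇒edgeOf≢ (a<b , l≡) e≡ = ℕ.<-irrefl (cong toℕ (≡-from-edgeOf-label e≡ l≡)) a<b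

    ¬CliquePair-matchingPair : ∀ e → ¬ CliquePair (matchingPair e)
    ¬CliquePair-matchingPair e q =
      CliquePair⇒edgeOf≢ q (trans (edgeOf-combine e zero) (sym (edgeOf-combine e (suc zero))))

    private
      edges-unique : Unique (edges T)
      edges-unique = Unique.++⁺
        (Unique.map⁺ matchingPair-injective (Unique.allFin⁺ m))
        (Unique.filter⁺ CliquePair? (subst Unique (sym (concatMap-pairs≡cartesianProduct (allEnds X) (allEnds X)))
                                       (Unique.cartesianProduct⁺ (Unique.allFin⁺ N) (Unique.allFin⁺ N))))
        disjoint
        where
        matchingPair-injective : ∀ {e f} → matchingPair e ≡ matchingPair f → e ≡ f
        matchingPair-injective {e} {f} eq = combine-injectiveˡ e zero f zero (cong proj₁ eq)
        disjoint : ∀ {p} → ¬ (p ∈ matchingEdges X × p ∈ cliqueEdges X)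
        disjoint (∈ms , ∈cs) with ∈-map⁻ matchingPair ∈ms
        ... | e , _ , refl = ¬CliquePair-matchingPair e (proj₂ (∈-filter⁻ CliquePair? {xs = allPairs} ∈cs))

    ends-injective : ∀ t u → ends T t ≡ ends T u → t ≡ u
    ends-injective = lookup-injective edges-unique

    count-label≡valency : ∀ v → count (λ y → label y ≟ v) ≡ valency X v
    count-label≡valency v = begin
      count (λ y → label y ≟ v)                                                     ≡⟨ ∑-combine m (λ y → 𝟙 (label y ≟ v)) ⟩
      ∑[ e < m ] ∑[ i < 2 ] 𝟙 (label (combine e i) ≟ v)                             ≡⟨ sum-cong-≗ ends-at-v ⟩
      count (λ e → Incident? v (ends X e))                                          ≡⟨ sym (valency≡count X v) ⟩
      valency X v                                                                   ∎
      where
      open ≡-Reasoning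
      ends-at-v : ∀ e → ∑[ i < 2 ] 𝟙 (label (combine e i) ≟ v) ≡ 𝟙 (Incident? v (ends X e))
      ends-at-v e = begin
        𝟙 (label (combine e zero) ≟ v) + (𝟙 (label (combine e (suc zero)) ≟ v) + 0)
          ≡⟨ cong₂ _+_ (at-endpoint zero) (trans (ℕ.+-identityʳ _) (at-endpoint (suc zero))) ⟩
        𝟙 (proj₁ (ends X e) ≟ v) + 𝟙 (proj₂ (ends X e) ≟ v)
          ≡⟨ sym (𝟙-⊎ (Incident? v (ends X e)) (proj₁ (ends X e) ≟ v) (proj₂ (ends X e) ≟ v)
                      (λ i → i) inj₁ inj₂ (λ p q → no-loop e (trans p (sym q)))) ⟩
        𝟙 (Incident? v (ends X e)) ∎
        where
        at-endpoint : ∀ i → 𝟙 (label (combine e i) ≟ v) ≡ 𝟙 (endpoint e i ≟ v)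
        at-endpoint i = 𝟙-cong (trans (sym (label-combine e i))) (trans (label-combine e i))
                               (label (combine e i) ≟ v) (endpoint e i ≟ v)

    module _ (x : Fin N) where

      private
        meets-x : Fin N × Fin N → ℕ
        meets-x p = 𝟙 (Incident? x p)

        above below : ℕ
        above  = count (λ b → CliquePair? (x , b))
        below = count (λ a → CliquePair? (a , x))

        matching-part : ∑ˡ (matchingEdges X) meets-x ≡ 1
        matching-part = begin
          ∑ˡ (map matchingPair (allFin m)) meets-x       ≡⟨ ∑ˡ-map matchingPair (allFin m) meets-x ⟩
          ∑ˡ (allFin m) (λ e → meets-x (matchingPair e)) ≡⟨ ∑ˡ-allFin m (λ e → meets-x (matchingPair e)) ⟩
          count (λ e → Incident? x (matchingPair e))        ≡⟨ count-unique (λ e → Incident? x (matchingPair e)) (edgeOf x)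
                                                                 (Incident-matchingPair-edgeOf x)
                                                                 (λ e f i j → trans (sym (Incident-matchingPair i)) (Incident-matchingPair j)) ⟩
          1                                                 ∎
          where open ≡-Reasoning

        clique-pair-at-x : ∀ a b → 𝟙 (CliquePair? (a , b)) * meets-x (a , b) ≡
                                   𝟙 (a ≟ x) * 𝟙 (CliquePair? (x , b)) + 𝟙 (b ≟ x) * 𝟙 (CliquePair? (a , x))
        clique-pair-at-x a b = go (a ≟ x) (b ≟ x)
          where
          go : (a≟x : Dec (a ≡ x)) (b≟x : Dec (b ≡ x)) → 𝟙 (CliquePair? (a , b)) * 𝟙 (a≟x ⊎-dec b≟x) ≡
                 𝟙 a≟x * 𝟙 (CliquePair? (x , b)) + 𝟙 b≟x * 𝟙 (CliquePair? (a , x))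
          go (yes refl) (yes refl) rewrite 𝟙-no (λ q → ℕ.<-irrefl refl (proj₁ q)) (CliquePair? (a , a)) = refl
          go (yes refl) (no _) = trans (ℕ.*-identityʳ _) (sym (trans (ℕ.+-identityʳ _) (ℕ.+-identityʳ _)))
          go (no _) (yes refl) = trans (ℕ.*-identityʳ _) (sym (ℕ.+-identityʳ _))
          go (no _) (no _)     = ℕ.*-zeroʳ (𝟙 (CliquePair? (a , b)))

        clique-part : ∑ˡ (cliqueEdges X) meets-x ≡ above + below
        clique-part = begin
          ∑ˡ (cliqueEdges X) meets-x
            ≡⟨ ∑ˡ-filter CliquePair? allPairs meets-x ⟩
          ∑ˡ allPairs (λ p → 𝟙 (CliquePair? p) * meets-x p)
            ≡⟨ ∑ˡ-pairs N (λ p → 𝟙 (CliquePair? p) * meets-x p) ⟩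
          ∑[ a < N ] ∑[ b < N ] (𝟙 (CliquePair? (a , b)) * meets-x (a , b))
            ≡⟨ sum-cong-≗ (λ a → trans (sum-cong-≗ (clique-pair-at-x a))
                                (∑-distrib-+ (λ b → 𝟙 (a ≟ x) * 𝟙 (CliquePair? (x , b))) (λ b → 𝟙 (b ≟ x) * 𝟙 (CliquePair? (a , x))))) ⟩
          ∑[ a < N ] (∑[ b < N ] (𝟙 (a ≟ x) * 𝟙 (CliquePair? (x , b))) + ∑[ b < N ] (𝟙 (b ≟ x) * 𝟙 (CliquePair? (a , x))))
            ≡⟨ sum-cong-≗ (λ a → cong₂ _+_ (sym (*-distribˡ-sum (𝟙 (a ≟ x)) (λ b → 𝟙 (CliquePair? (x , b)))))
                                            (∑-singleton-* x (𝟙 (CliquePair? (a , x))))) ⟩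
          ∑[ a < N ] (𝟙 (a ≟ x) * above + 𝟙 (CliquePair? (a , x)))
            ≡⟨ ∑-distrib-+ (λ a → 𝟙 (a ≟ x) * above) (λ a → 𝟙 (CliquePair? (a , x))) ⟩
          ∑[ a < N ] (𝟙 (a ≟ x) * above) + below
            ≡⟨ cong (_+ below) (∑-singleton-* x above) ⟩
          above + below ∎
          where open ≡-Reasoning

        Other : Fin N → Set
        Other y = y ≢ x × label y ≡ label x

        Other? : Decidable Other
        Other? y = ¬? (y ≟ x) ×-dec (label y ≟ label x)

        same-label-split : ∀ y → 𝟙 (label y ≟ label x) ≡ 𝟙 (y ≟ x) + (𝟙 (CliquePair? (x , y)) + 𝟙 (CliquePair? (y , x)))
        same-label-split y =
          trans (𝟙-⊎ (label y ≟ label x) (y ≟ x) (Other? y) x-or-other (cong label) proj₂ (λ y≡x o → proj₁ o y≡x))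
                (cong (𝟙 (y ≟ x) +_) (𝟙-⊎ (Other? y) (CliquePair? (x , y)) (CliquePair? (y , x)) by-order
                  (λ { (x<y , l≡) → (λ { refl → ℕ.<-irrefl refl x<y }) , sym l≡ })
                  (λ { (y<x , l≡) → (λ { refl → ℕ.<-irrefl refl y<x }) , l≡ })
                  (λ q r → ℕ.<-asym (proj₁ q) (proj₁ r))))
          where
          x-or-other : label y ≡ label x → y ≡ x ⊎ Other y
          x-or-other l≡ with y ≟ x
          ... | yes y≡x = inj₁ y≡x
          ... | no y≢x  = inj₂ (y≢x , l≡)
          by-order : Other y → CliquePair (x , y) ⊎ CliquePair (y , x)
          by-order (y≢x , l≡) with ℕ.<-cmp (toℕ x) (toℕ y)
          ... | tri< x<y _ _ = inj₁ (x<y , sym l≡)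
          ... | tri≈ _ x≡y _ = ⊥-elim (y≢x (sym (toℕ-injective x≡y)))
          ... | tri> _ _ y<x = inj₂ (y<x , l≡)

      valency-truncation : valency T x ≡ count (λ y → label y ≟ label x)
      valency-truncation = begin
        valency T x
          ≡⟨ length-filter (Incident? x) (edges T) ⟩
        ∑ˡ (matchingEdges X ++ cliqueEdges X) meets-x
          ≡⟨ ∑ˡ-++ (matchingEdges X) (cliqueEdges X) meets-x ⟩
        ∑ˡ (matchingEdges X) meets-x + ∑ˡ (cliqueEdges X) meets-x
          ≡⟨ cong₂ _+_ matching-part clique-part ⟩
        1 + (above + below)
          ≡⟨ cong₂ _+_ (sym (count-singleton x)) (sym (∑-distrib-+ (λ y → 𝟙 (CliquePair? (x , y))) (λ y → 𝟙 (CliquePair? (y , x))))) ⟩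
        count (_≟ x) + ∑[ y < N ] (𝟙 (CliquePair? (x , y)) + 𝟙 (CliquePair? (y , x)))
          ≡⟨ sym (∑-distrib-+ (λ y → 𝟙 (y ≟ x)) (λ y → 𝟙 (CliquePair? (x , y)) + 𝟙 (CliquePair? (y , x)))) ⟩
        ∑[ y < N ] (𝟙 (y ≟ x) + (𝟙 (CliquePair? (x , y)) + 𝟙 (CliquePair? (y , x))))
          ≡⟨ sum-cong-≗ (λ y → sym (same-label-split y)) ⟩
        count (λ y → label y ≟ label x) ∎
        where open ≡-Reasoning

    regular-truncation : ∀ {k} → Regular X k → Regular T k
    regular-truncation regular x =
      trans (valency-truncation x) (trans (count-label≡valency (label x)) (regular (label x)))

module ColourTruncation (X : Multigraph) (loopless : Loopless X) (j : ℕ) where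
  open Truncation X
  open Midpoint j

  module _ {c : Edge X → Fin K} (proper : ProperEdgeColouring X K c) where

    γ : Fin N → Fin K
    γ y = c (edgeOf y)

    γ-injective-on-labels : ∀ {y z} → label y ≡ label z → γ y ≡ γ z → y ≡ z
    γ-injective-on-labels {y} {z} l≡ γ≡ with edgeOf y ≟ edgeOf z
    ... | yes e≡ = ≡-from-edgeOf-label loopless e≡ l≡
    ... | no e≢  = ⊥-elim (proper (edgeOf y) (edgeOf z) e≢ (ShareEnd-intro (Incident-label-edgeOf loopless y) z∈) γ≡)
      where
      z∈ : Incident (label y) (ends X (edgeOf z))
      z∈ = subst (λ v → Incident v (ends X (edgeOf z))) (sym l≡) (Incident-label-edgeOf loopless z)

    pairColour : Fin N × Fin N → Fin K
    pairColour (a , b) with edgeOf a ≟ edgeOf b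
    ... | yes _ = c (edgeOf a)
    ... | no _  = midpoint (γ a) (γ b)

    pairColour-matchingPair : ∀ e → pairColour (matchingPair e) ≡ c e
    pairColour-matchingPair e with edgeOf (combine e zero) ≟ edgeOf (combine e (suc zero))
    ... | yes _ = cong c (edgeOf-combine e zero)
    ... | no e≢ = ⊥-elim (e≢ (trans (edgeOf-combine e zero) (sym (edgeOf-combine e (suc zero)))))

    pairColour-CliquePair : ∀ {a b} → CliquePair (a , b) → pairColour (a , b) ≡ midpoint (γ a) (γ b)
    pairColour-CliquePair {a} {b} q with edgeOf a ≟ edgeOf b
    ... | yes e≡ = ⊥-elim (CliquePair⇒edgeOf≢ loopless q e≡)
    ... | no _   = refl

    other-end : ∀ {a b z} → CliquePair (a , b) → Incident z (a , b) →
                ∃ λ o → o ≢ z × label o ≡ label z × Incident o (a , b) × midpoint (γ a) (γ b) ≡ midpoint (γ z) (γ o)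
    other-end {a} {b} (a<b , l≡) (inj₁ refl) = b , (λ { refl → ℕ.<-irrefl refl a<b }) , sym l≡ , inj₂ refl , refl
    other-end {a} {b} (a<b , l≡) (inj₂ refl) = a , (λ { refl → ℕ.<-irrefl refl a<b }) , l≡ , inj₁ refl , midpoint-comm (γ a) (γ b)

    matching-vs-clique : ∀ {e a b} → CliquePair (a , b) → ShareEnd (matchingPair e) (a , b) → c e ≢ midpoint (γ a) (γ b)
    matching-vs-clique {e} q share ce≡ with ShareEnd-elim share
    ... | z , z∈e , z∈ab with other-end q z∈ab
    ...   | o , o≢z , l≡ , _ , mid≡ = o≢z (γ-injective-on-labels l≡ (midpoint≡ˡ⇒≡ (γ z) (γ o) (begin
      midpoint (γ z) (γ o)   ≡⟨ sym mid≡ ⟩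
      _                      ≡⟨ sym ce≡ ⟩
      c e                    ≡⟨ cong c (sym (Incident-matchingPair z∈e)) ⟩
      γ z                    ∎)))
      where open ≡-Reasoning

    clique-vs-clique : ∀ {p q} → CliquePair p → CliquePair q → p ≢ q → ShareEnd p q →
                       midpoint (γ (proj₁ p)) (γ (proj₂ p)) ≢ midpoint (γ (proj₁ q)) (γ (proj₂ q))
    clique-vs-clique cp cq p≢q share mid≡ with ShareEnd-elim share
    ... | z , z∈p , z∈q with other-end cp z∈p | other-end cq z∈q
    ...   | o , o≢z , l≡ , o∈p , mid≡p | o′ , _ , l′≡ , o′∈q , mid≡q =
      p≢q (increasing-pair-unique (proj₁ cp) (proj₁ cq) (≢-sym o≢z) z∈p o∈p z∈q (subst (λ w → Incident w _) (sym o≡o′) o′∈q))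
      where
      o≡o′ : o ≡ o′
      o≡o′ = γ-injective-on-labels (trans l≡ (sym l′≡))
               (midpoint-injectiveʳ (γ z) (γ o) (γ o′) (trans (sym mid≡p) (trans mid≡ mid≡q)))

    pairColour-proper : ∀ {p q} → MatchingOrClique p → MatchingOrClique q → p ≢ q → ShareEnd p q → pairColour p ≢ pairColour q
    pairColour-proper (inj₁ (e , refl)) (inj₁ (f , refl)) p≢q share _ with ShareEnd-elim share
    ... | z , z∈e , z∈f = p≢q (cong matchingPair (trans (sym (Incident-matchingPair z∈e)) (Incident-matchingPair z∈f)))
    pairColour-proper (inj₁ (e , refl)) (inj₂ cq) p≢q share colour≡ =
      matching-vs-clique cq share (trans (sym (pairColour-matchingPair e)) (trans colour≡ (pairColour-CliquePair cq)))
    pairColour-proper (inj₂ cp) (inj₁ (e , refl)) p≢q share colour≡ with ShareEnd-elim share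
    ... | z , z∈p , z∈e = matching-vs-clique cp (ShareEnd-intro z∈e z∈p)
                            (trans (sym (pairColour-matchingPair e)) (trans (sym colour≡) (pairColour-CliquePair cp)))
    pairColour-proper (inj₂ cp) (inj₂ cq) p≢q share colour≡ =
      clique-vs-clique cp cq p≢q share (trans (sym (pairColour-CliquePair cp)) (trans colour≡ (pairColour-CliquePair cq)))

  truncation-colourable : EdgeColourable X K → EdgeColourable T K
  truncation-colourable (c , proper) = (λ t → pairColour proper (ends T t)) , λ t u t≢u share →
    pairColour-proper proper (matching-or-clique t) (matching-or-clique u) (λ ends≡ → t≢u (ends-injective loopless t u ends≡)) share

module ColourFromTruncation (X : Multigraph) (loopless : Loopless X) {k : ℕ} (regular : Regular X k) (k-odd : Odd k) where
  open Truncation X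

  module _ {c : Edge T → Fin k} (proper : ProperEdgeColouring T k c) where

    γ : Fin N → Fin k
    γ x = c (matchingEdge (edgeOf x))

    κ : Fin N → Fin N → Fin k
    κ x y with ℕ.<-cmp (toℕ x) (toℕ y) | label x ≟ label y
    ... | tri< x<y _ _ | yes l≡ = c (cliqueEdge x y (x<y , l≡))
    ... | tri> _ _ y<x | yes l≡ = c (cliqueEdge y x (y<x , sym l≡))
    ... | _            | _      = γ x  -- junk: κ is only used on distinct ends with equal labels

    κ-realised : ∀ {x y} → x ≢ y → label x ≡ label y → ∃ λ t → CliqueEdgeBetween x y t × κ x y ≡ c t
    κ-realised {x} {y} x≢y l≡ with ℕ.<-cmp (toℕ x) (toℕ y) | label x ≟ label y
    ... | tri< x<y _ _ | yes l≡′ = cliqueEdge x y (x<y , l≡′) , cliqueEdge-between (x<y , l≡′) , refl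
    ... | tri> _ _ y<x | yes l≡′ = cliqueEdge y x (y<x , sym l≡′) , CliqueEdgeBetween-sym (cliqueEdge-between (y<x , sym l≡′)) , refl
    ... | tri≈ _ x≡y _ | _       = ⊥-elim (x≢y (toℕ-injective x≡y))
    ... | tri< _ _ _   | no l≢   = ⊥-elim (l≢ l≡)
    ... | tri> _ _ _   | no l≢   = ⊥-elim (l≢ l≡)

    module _ (v : Fin (n X)) where

      L : Fin N → Set
      L y = label y ≡ v

      κ-sym : ∀ {x y} → L x → L y → x ≢ y → κ x y ≡ κ y x
      κ-sym {x} {y} lx ly x≢y with κ-realised x≢y (trans lx (sym ly)) | κ-realised (≢-sym x≢y) (trans ly (sym lx))
      ... | t , (ct , x∈t , y∈t) , κxy≡ | u , (cu , y∈u , x∈u) , κyx≡ = begin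
        κ x y   ≡⟨ κxy≡ ⟩
        c t     ≡⟨ cong c (ends-injective loopless t u (increasing-pair-unique (proj₁ ct) (proj₁ cu) x≢y x∈t y∈t x∈u y∈u)) ⟩
        c u     ≡⟨ sym κyx≡ ⟩
        κ y x   ∎
        where open ≡-Reasoning

      κ≢γ : ∀ {x y} → L x → L y → x ≢ y → κ x y ≢ γ x
      κ≢γ {x} lx ly x≢y with κ-realised x≢y (trans lx (sym ly))
      ... | t , (ct , x∈t , _) , κxy≡ = λ κ≡γ → proper t (matchingEdge (edgeOf x)) t≢m
                                            (ShareEnd-intro x∈t x∈m) (trans (sym κxy≡) κ≡γ)
        where
        x∈m : Incident x (ends T (matchingEdge (edgeOf x)))
        x∈m = subst (Incident x) (sym (ends-matchingEdge (edgeOf x))) (Incident-matchingPair-edgeOf x)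
        t≢m : t ≢ matchingEdge (edgeOf x)
        t≢m refl = ¬CliquePair-matchingPair loopless (edgeOf x) (subst CliquePair (ends-matchingEdge (edgeOf x)) ct)

      κ-proper : ∀ {x y z} → L x → L y → L z → x ≢ y → x ≢ z → y ≢ z → κ x y ≢ κ x z
      κ-proper {x} {y} {z} lx ly lz x≢y x≢z y≢z with κ-realised x≢y (trans lx (sym ly)) | κ-realised x≢z (trans lx (sym lz))
      ... | t , (_ , x∈t , y∈t) , κxy≡ | u , (_ , x∈u , z∈u) , κxz≡ =
        λ κ≡ → proper t u t≢u (ShareEnd-intro x∈t x∈u) (trans (sym κxy≡) (trans κ≡ κxz≡))
        where
        t≢u : t ≢ u
        t≢u refl with pair-has-two-ends x∈t y∈t z∈u
        ... | inj₁ x≡y        = x≢y x≡y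
        ... | inj₂ (inj₁ x≡z) = x≢z x≡z
        ... | inj₂ (inj₂ y≡z) = y≢z y≡z

      γ-injective : ∀ {x y} → L x → L y → γ x ≡ γ y → x ≡ y
      γ-injective {x} {y} = PendantColouring.pendant-colours-injective (λ y → label y ≟ v)
        (trans (count-label≡valency loopless v) (regular v)) γ κ κ-sym κ≢γ κ-proper k-odd x y

  colourable-from-truncation : EdgeColourable T k → EdgeColourable X k
  colourable-from-truncation (c , proper) = d , d-proper
    where
    d : Edge X → Fin k
    d e = c (matchingEdge e)
    d-proper : ProperEdgeColouring X k d
    d-proper e f e≢f share de≡df with ShareEnd-elim share
    ... | w , w∈e , w∈f with end-labelled w∈e | end-labelled w∈f
    ...   | a , refl , la | b , refl , lb = e≢f (cong edgeOf (γ-injective proper w la lb de≡df))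

corollary4p3 : (X : Multigraph) (k : ℕ) → Loopless X → Regular X k → Odd k →
    (ClassI X ⇔ ClassI (completeTruncation X))
corollary4p3 (mkGraph zero [])                 _ _ _ _ = mk⇔ (λ _ → ClassI-edgeless 0) (λ _ → ClassI-edgeless 0)
corollary4p3 (mkGraph zero ((() , _) ∷ _))     _ _ _ _
corollary4p3 (mkGraph (suc _) [])              _ _ regular (j , k≡2j+1) with trans (regular zero) k≡2j+1
... | ()
corollary4p3 X@(mkGraph (suc _) (_ ∷ _)) .(suc (j + j)) loopless regular k-odd@(j , refl) = begin
  ClassI X                         ≈⟨ ClassI⇔colourable-regular X regular zero ⟩
  EdgeColourable X (suc (j + j))   ≈⟨ mk⇔ (truncation-colourable X loopless j) (colourable-from-truncation X loopless regular k-odd) ⟩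
  EdgeColourable T (suc (j + j))   ≈⟨ ClassI⇔colourable-regular T (regular-truncation loopless regular) zero ⟨
  ClassI T                         ∎
  where
  open Truncation X using (T; regular-truncation)
  open ColourTruncation using (truncation-colourable)
  open ColourFromTruncation using (colourable-from-truncation)
  open import Relation.Binary.Reasoning.Setoid (⇔-setoid 0ℓ)
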